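{- Let $a,b$ be integers with $2 \le a \le 2b$ and $2 \le b \le 2a$, let $R$ be the $(a,b)$-benzel, and let $c \in \{0,1,-1\}$ be its class, i.e. $c \equiv a+b \pmod 3$. Then the area of $R$ (the number of unit hexagonal cells it contains) is $$\begin{cases} (-a^2+4ab-b^2-a-b)/2 & \text{if } c \in \{0,-1\},\\ (-a^2+4ab-b^2-a-b+2)/2 & \text{if } c = 1.\end{cases}$$
   Context: Identify the plane with $\mathbb{C}$ and let $\omega = e^{2\pi i/3}$. Let $L = \mathbb{Z}+\mathbb{Z}\omega$ and for $r \in \{0,1,-1\}$ let $L_r = \{x + y\omega : x,y \in \mathbb{Z},\ x+y \equiv r \pmod 3\}$, so $L_0$ is an index-three sublattice of $L$ and $L_1 = L_0+1$, $L_{ -1} = L_0 - 1$. The hexagonal grid is the graph with vertex set $L_0 \cup L_1$ and an edge between two vertices at distance $1$. Each $\alpha \in L_{ -1}$ is the center of a unit hexagonal cell with corners $\alpha \pm 1, \alpha \pm \omega, \alpha \pm \omega^2$; these cells tile the plane. For integers $a,b$ with $2 \le a \le 2b$ and $2 \le b \le 2a$, the $(a,b)$-benzel is the union of all unit hexagonal cells lying entirely within the (bounding) hexagon with vertices $a\omega+b$, $-a\omega^2-b$, $a\omega^2+b\omega$, $-a-b\omega$, $a+b\omega^2$, $-a\omega-b\omega^2$. Its class is the residue $c \in \{0,1,-1\}$ of $a+b$ modulo $3$. The area of a region is the number of unit cells in it. -}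

module Defs where

open import Data.Integer using (ℤ; +_; -_; _+_; _-_; _*_; _≤_)
open import Data.Integer.Divisibility using (_∣_)
open import Data.List using (List; _∷_; [])
open import Data.List.Relation.Unary.All using (All)
open import Data.Product using (_×_)

-- Eisenstein integers x + y ω  (ω = e^{2πi/3}, ω² = -1 - ω), coordinates (x , y).
record E : Set where
  constructor mkE
  field
    re : ℤ
    im : ℤ
open E public

infixl 6 _⊕_ _⊖_
infixl 7 _⊗_

_⊕_ : E → E → E
mkE x₁ y₁ ⊕ mkE x₂ y₂ = mkE (x₁ + x₂) (y₁ + y₂)

⊝_ : E → E
⊝ mkE x y = mkE (- x) (- y)

_⊖_ : E → E → E
p ⊖ q = p ⊕ (⊝ q)

-- (x₁ + y₁ω)(x₂ + y₂ω) = (x₁x₂ - y₁y₂) + (x₁y₂ + x₂y₁ - y₁y₂)ω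
_⊗_ : E → E → E
mkE x₁ y₁ ⊗ mkE x₂ y₂ = mkE (x₁ * x₂ - y₁ * y₂) (x₁ * y₂ + x₂ * y₁ - y₁ * y₂)

ι : ℤ → E
ι n = mkE n (+ 0)

𝟙 ω ω² : E
𝟙 = ι (+ 1)
ω = mkE (+ 0) (+ 1)
ω² = ω ⊗ ω

InL : ℤ → E → Set
InL r (mkE x y) = + 3 ∣ (x + y - r)

-- Orientation: cross p q has the same sign as Im( conj(p) q ), since the
-- basis (1, ω) is positively oriented (Im ω = √3/2 > 0).
cross : E → E → ℤ
cross (mkE x₁ y₁) (mkE x₂ y₂) = x₁ * y₂ - y₁ * x₂

LeftOf : E → E → E → Set
LeftOf u v p = + 0 ≤ cross (v ⊖ u) (p ⊖ u)

-- Closed region bounded by a convex hexagon with vertices v₁,…,v₆ listed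
-- counterclockwise: intersection of the six closed half-planes.
InConvexHexagon : E → E → E → E → E → E → E → Set
InConvexHexagon v₁ v₂ v₃ v₄ v₅ v₆ p =
  LeftOf v₁ v₂ p × LeftOf v₂ v₃ p × LeftOf v₃ v₄ p ×
  LeftOf v₄ v₅ p × LeftOf v₅ v₆ p × LeftOf v₆ v₁ p

InBoundingHexagon : ℤ → ℤ → E → Set
InBoundingHexagon a b =
  InConvexHexagon (ι a ⊗ ω ⊕ ι b)
                  (⊝ (ι a ⊗ ω²) ⊖ ι b)
                  (ι a ⊗ ω² ⊕ ι b ⊗ ω)
                  (⊝ (ι a) ⊖ ι b ⊗ ω)
                  (ι a ⊕ ι b ⊗ ω²)
                  (⊝ (ι a ⊗ ω) ⊖ ι b ⊗ ω²)

corners : E → List E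
corners α = α ⊕ 𝟙 ∷ α ⊖ 𝟙 ∷ α ⊕ ω ∷ α ⊖ ω ∷ α ⊕ ω² ∷ α ⊖ ω² ∷ []

-- The cell (convex hull of its corners) lies in the (convex, closed) bounding
-- hexagon iff all its corners do.
CellWithin : ℤ → ℤ → E → Set
CellWithin a b α = All (InBoundingHexagon a b) (corners α)

InBenzel : ℤ → ℤ → E → Set
InBenzel a b α = InL (- + 1) α × CellWithin a b α

data Residue : Set where
  r0 r1 r-1 : Residue

residueℤ : Residue → ℤ
residueℤ r0 = + 0
residueℤ r1 = + 1
residueℤ r-1 = - + 1

IsClass : ℤ → ℤ → Residue → Set
IsClass a b c = + 3 ∣ (a + b - residueℤ c)

twiceArea : ℤ → ℤ → Residue → ℤ
twiceArea a b r1 = - (a * a) + + 4 * a * b - b * b - a - b + + 2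
twiceArea a b r0 = - (a * a) + + 4 * a * b - b * b - a - b
twiceArea a b r-1 = - (a * a) + + 4 * a * b - b * b - a - b

-- Writing a cell centre as x + yω, the bounding hexagon is -a ≤ x ≤ b, -b ≤ y ≤ a,
-- -b ≤ x - y ≤ a (its edges have lengths proportional to 2b - a and 2a - b), so a cell
-- fits iff its centre satisfies the strict inequalities -a < x < b, -b < y < a,
-- -b < x - y < a. Cut this hexagon of centres below the row y = m + 1, where
-- m = b - a - 1 (or m = b - a if a = 2b). The rows y = 1 - b, …, m of the lower part
-- have lengths 2a - b, …, m + 2a - 1, and the reflection α ↦ -α turns the upper part
-- into the lower part of the (b, a)-hexagon for the class L₁. A row of length ℓ contains
-- ⌊(ℓ + 1)/3⌋ points of either class L₋₁, L₁, so each part contributes T(hi) - T(lo)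
-- where 6 T(n) = n² - n - 2·[n ≡ 2 (mod 3)]. The four arguments a + b - 1, a + b,
-- 2a - b and 2b - a have residues determined by the class c, which gives the formula.

module Submission where

open import Defs

module Rows where

  open import Data.Bool using (true; false)
  open import Data.Nat
  open import Data.Nat.Properties
    using (+-suc; +-assoc; +-identityʳ; ≤-refl; m≤m+n; m≤n⇒m≤1+n; m≤n⇒m<n∨m≡n; <-irrefl; ≤-<-trans)
  open import Data.Nat.Divisibility using (_∣_; _∣?_; ∣m+n∣m⇒∣n; ∣m∣n⇒∣m+n; ∣-refl; m∣m*n)
  open import Data.Nat.Tactic.RingSolver using (solve-∀)
  open import Data.List using (List; []; _∷_; map; _++_; filter; length; downFrom)
  open import Data.List.Properties using (filter-≐; filter-++; length-++; length-map)
  open import Data.List.Membership.Propositional using (_∈_)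
  open import Data.List.Membership.Propositional.Properties
    using (∈-filter⁺; ∈-filter⁻; ∈-downFrom⁺; ∈-downFrom⁻; ∈-map⁺; ∈-map⁻;
           ∈-++⁺ˡ; ∈-++⁺ʳ; ∈-++⁻)
  open import Data.List.Relation.Unary.Unique.Propositional using (Unique)
  open import Data.List.Relation.Unary.AllPairs using ([])
  import Data.List.Relation.Unary.Unique.Propositional.Properties as Unique
  open import Data.Product using (_×_; _,_; _,′_; proj₁; proj₂)
  open import Data.Sum using (inj₁; inj₂)
  open import Data.Empty using (⊥-elim)
  open import Function.Base using (_∘_)
  open import Function.Bundles using (_⇔_; mk⇔; Equivalence)
  open import Level using (0ℓ)
  open import Relation.Nullary using (does; ¬_)
  open import Relation.Nullary.Decidable using (from-no)
  open import Relation.Unary using (Pred; Decidable; _≐_)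
  open import Relation.Binary.PropositionalEquality

  length-filter-map : ∀ {A B : Set} {P : Pred B 0ℓ} (P? : Decidable P) (f : A → B) xs →
    length (filter P? (map f xs)) ≡ length (filter (P? ∘ f) xs)
  length-filter-map P? f [] = refl
  length-filter-map P? f (x ∷ xs) with does (P? (f x))
  ... | true  = cong suc (length-filter-map P? f xs)
  ... | false = length-filter-map P? f xs

  3∣-≐ : ∀ {f g : ℕ → ℕ} k → (∀ t → f t ≡ 3 * k + g t) → (λ t → 3 ∣ f t) ≐ (λ t → 3 ∣ g t)
  3∣-≐ k f≡g = (λ {t} 3∣f → ∣m+n∣m⇒∣n (subst (3 ∣_) (f≡g t) 3∣f) (m∣m*n k)) ,
               (λ {t} 3∣g → subst (3 ∣_) (sym (f≡g t)) (∣m∣n⇒∣m+n (m∣m*n k) 3∣g))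

  one-of-three : ∀ n → length (filter (λ t → 3 ∣? t + n) (2 ∷ 1 ∷ 0 ∷ [])) ≡ 1
  one-of-three 0 = refl
  one-of-three 1 = refl
  one-of-three 2 = refl
  one-of-three (suc (suc (suc n))) =
    trans (cong length (filter-≐ (λ t → 3 ∣? t + (3 + n)) (λ t → 3 ∣? t + n) (3∣-≐ 1 (+3 n))
                                 (2 ∷ 1 ∷ 0 ∷ [])))
          (one-of-three n)
    where
    +3 : ∀ n t → t + (3 + n) ≡ 3 * 1 + (t + n)
    +3 = solve-∀

  row : ℕ → ℕ → List ℕ
  row s ℓ = filter (λ t → 3 ∣? t + ℓ + s) (downFrom ℓ)

  ∈-row : ∀ {s ℓ t} → t ∈ row s ℓ ⇔ (t < ℓ × 3 ∣ t + ℓ + s)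
  ∈-row = mk⇔ (λ t∈ → let t∈↓ , 3∣ = ∈-filter⁻ _ t∈ in ∈-downFrom⁻ t∈↓ , 3∣)
              (λ (t<ℓ , 3∣) → ∈-filter⁺ _ (∈-downFrom⁺ t<ℓ) 3∣)

  row-unique : ∀ s ℓ → Unique (row s ℓ)
  row-unique s ℓ = Unique.filter⁺ _ (Unique.downFrom⁺ ℓ)

  length-row-3+ : ∀ s ℓ → length (row s (3 + ℓ)) ≡ suc (length (row s ℓ))
  length-row-3+ s ℓ = begin
    length (filter P? (map (_+ ℓ) (2 ∷ 1 ∷ 0 ∷ []) ++ downFrom ℓ))
      ≡⟨ cong length (filter-++ P? (map (_+ ℓ) (2 ∷ 1 ∷ 0 ∷ [])) (downFrom ℓ)) ⟩
    length (filter P? (map (_+ ℓ) (2 ∷ 1 ∷ 0 ∷ [])) ++ filter P? (downFrom ℓ))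
      ≡⟨ length-++ (filter P? (map (_+ ℓ) (2 ∷ 1 ∷ 0 ∷ []))) ⟩
    length (filter P? (map (_+ ℓ) (2 ∷ 1 ∷ 0 ∷ []))) + length (filter P? (downFrom ℓ))
      ≡⟨ cong₂ _+_ new-points (cong length (filter-≐ P? Q? (3∣-≐ 1 (shift ℓ s)) (downFrom ℓ))) ⟩
    suc (length (row s ℓ)) ∎
    where
    open ≡-Reasoning
    P? : Decidable (λ t → 3 ∣ t + (3 + ℓ) + s)
    P? t = 3 ∣? t + (3 + ℓ) + s
    Q? : Decidable (λ t → 3 ∣ t + ℓ + s)
    Q? t = 3 ∣? t + ℓ + s
    shift : ∀ ℓ s t → t + (3 + ℓ) + s ≡ 3 * 1 + (t + ℓ + s)
    shift = solve-∀
    regroup : ∀ ℓ s t → t + ℓ + (3 + ℓ) + s ≡ 3 * 0 + (t + (ℓ + (3 + ℓ) + s))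
    regroup = solve-∀
    new-points : length (filter P? (map (_+ ℓ) (2 ∷ 1 ∷ 0 ∷ []))) ≡ 1
    new-points = begin
      length (filter P? (map (_+ ℓ) (2 ∷ 1 ∷ 0 ∷ [])))
        ≡⟨ length-filter-map P? (_+ ℓ) (2 ∷ 1 ∷ 0 ∷ []) ⟩
      length (filter (P? ∘ (_+ ℓ)) (2 ∷ 1 ∷ 0 ∷ []))
        ≡⟨ cong length (filter-≐ (P? ∘ (_+ ℓ)) (λ t → 3 ∣? t + (ℓ + (3 + ℓ) + s))
                                 (3∣-≐ 0 (regroup ℓ s)) (2 ∷ 1 ∷ 0 ∷ [])) ⟩
      length (filter (λ t → 3 ∣? t + (ℓ + (3 + ℓ) + s)) (2 ∷ 1 ∷ 0 ∷ []))
        ≡⟨ one-of-three (ℓ + (3 + ℓ) + s) ⟩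
      1 ∎

  rowCount : ℕ → ℕ
  rowCount 0 = 0
  rowCount 1 = 0
  rowCount 2 = 1
  rowCount (suc (suc (suc ℓ))) = suc (rowCount ℓ)

  length-row : ∀ {s} → s < 2 → ∀ ℓ → length (row s ℓ) ≡ rowCount ℓ
  length-row {0} _ 0 = refl
  length-row {0} _ 1 = refl
  length-row {0} _ 2 = refl
  length-row {1} _ 0 = refl
  length-row {1} _ 1 = refl
  length-row {1} _ 2 = refl
  length-row {suc (suc _)} (s≤s (s≤s ())) _
  length-row {s} s<2 (suc (suc (suc ℓ))) = trans (length-row-3+ s ℓ) (cong suc (length-row s<2 ℓ))

  rows : ℕ → ℕ → ℕ → List (ℕ × ℕ)
  rows s lo zero    = []
  rows s lo (suc k) = map (lo + k ,′_) (row s (lo + k)) ++ rows s lo k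

  ∈-rows : ∀ {s lo k ℓ t} → (ℓ , t) ∈ rows s lo k ⇔ (lo ≤ ℓ × ℓ < lo + k × t ∈ row s ℓ)
  ∈-rows {s} {lo} {k} = mk⇔ (to k) (from k)
    where
    to : ∀ k {ℓ t} → (ℓ , t) ∈ rows s lo k → lo ≤ ℓ × ℓ < lo + k × t ∈ row s ℓ
    to (suc k) p with ∈-++⁻ (map (lo + k ,′_) (row s (lo + k))) p
    ... | inj₁ p′ with ∈-map⁻ (lo + k ,′_) p′
    ...   | _ , t∈ , refl = m≤m+n lo k , subst (lo + k <_) (sym (+-suc lo k)) ≤-refl , t∈
    to (suc k) {ℓ} p | inj₂ p′ with to k p′
    ...   | lo≤ℓ , ℓ< , t∈ = lo≤ℓ , subst (ℓ <_) (sym (+-suc lo k)) (m≤n⇒m≤1+n ℓ<) , t∈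
    from : ∀ k {ℓ t} → lo ≤ ℓ × ℓ < lo + k × t ∈ row s ℓ → (ℓ , t) ∈ rows s lo k
    from zero (lo≤ℓ , ℓ< , _) = ⊥-elim (<-irrefl refl (≤-<-trans lo≤ℓ (subst (_ <_) (+-identityʳ lo) ℓ<)))
    from (suc k) {ℓ} {t} (lo≤ℓ , ℓ< , t∈) with m≤n⇒m<n∨m≡n (s≤s⁻¹ (subst (ℓ <_) (+-suc lo k) ℓ<))
    ... | inj₁ ℓ<lo+k = ∈-++⁺ʳ (map (lo + k ,′_) (row s (lo + k))) (from k (lo≤ℓ , ℓ<lo+k , t∈))
    ... | inj₂ ℓ≡lo+k = subst (λ ℓ → (ℓ , t) ∈ rows s lo (suc k)) (sym ℓ≡lo+k)
                           (∈-++⁺ˡ (∈-map⁺ (lo + k ,′_) (subst (λ ℓ → t ∈ row s ℓ) ℓ≡lo+k t∈)))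

  rows-unique : ∀ s lo k → Unique (rows s lo k)
  rows-unique s lo zero    = []
  rows-unique s lo (suc k) =
    Unique.++⁺ (Unique.map⁺ (cong proj₂) (row-unique s (lo + k))) (rows-unique s lo k) disjoint
    where
    disjoint : ∀ {p} → ¬ (p ∈ map (lo + k ,′_) (row s (lo + k)) × p ∈ rows s lo k)
    disjoint (p∈ , p∈′) with ∈-map⁻ (lo + k ,′_) p∈
    ... | _ , _ , refl = <-irrefl refl (proj₁ (proj₂ (Equivalence.to (∈-rows {s} {lo} {k}) p∈′)))

  triangle : ℕ → ℕ
  triangle zero    = 0
  triangle (suc n) = rowCount n + triangle n

  length-rows : ∀ {s} → s < 2 → ∀ lo k → length (rows s lo k) + triangle lo ≡ triangle (lo + k)
  length-rows s<2 lo zero    = cong triangle (sym (+-identityʳ lo))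
  length-rows {s} s<2 lo (suc k) = begin
    length (map (lo + k ,′_) (row s (lo + k)) ++ rows s lo k) + triangle lo
      ≡⟨ cong (_+ triangle lo) (length-++ (map (lo + k ,′_) (row s (lo + k))) {rows s lo k}) ⟩
    length (map (lo + k ,′_) (row s (lo + k))) + length (rows s lo k) + triangle lo
      ≡⟨ +-assoc (length (map (lo + k ,′_) (row s (lo + k)))) _ _ ⟩
    length (map (lo + k ,′_) (row s (lo + k))) + (length (rows s lo k) + triangle lo)
      ≡⟨ cong₂ _+_ (trans (length-map (lo + k ,′_) (row s (lo + k))) (length-row s<2 (lo + k)))
                   (length-rows s<2 lo k) ⟩
    triangle (suc (lo + k))
      ≡⟨ cong triangle (sym (+-suc lo k)) ⟩
    triangle (lo + suc k) ∎
    where open ≡-Reasoning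

  rowCount-three : ∀ m → rowCount m + rowCount (1 + m) + rowCount (2 + m) ≡ suc m
  rowCount-three 0 = refl
  rowCount-three 1 = refl
  rowCount-three 2 = refl
  rowCount-three (suc (suc (suc m))) =
    trans (sucs (rowCount m) (rowCount (1 + m)) (rowCount (2 + m))) (cong (3 +_) (rowCount-three m))
    where
    sucs : ∀ a b c → suc a + suc b + suc c ≡ 3 + (a + b + c)
    sucs = solve-∀

  HasResidueℕ : ℕ → Residue → Set
  HasResidueℕ n r0  = 3 ∣ n
  HasResidueℕ n r1  = 3 ∣ 2 + n
  HasResidueℕ n r-1 = 3 ∣ 1 + n

  HasResidueℕ-3+ : ∀ d {m} → HasResidueℕ (3 + m) d → HasResidueℕ m d
  HasResidueℕ-3+ r0  h = ∣m+n∣m⇒∣n h ∣-refl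
  HasResidueℕ-3+ r1  h = ∣m+n∣m⇒∣n h ∣-refl
  HasResidueℕ-3+ r-1 h = ∣m+n∣m⇒∣n h ∣-refl

  defect : Residue → ℕ
  defect r0  = 0
  defect r1  = 0
  defect r-1 = 2

  triangle-closed : ∀ n d → HasResidueℕ n d → 6 * triangle n + n + defect d ≡ n * n
  triangle-closed 0 r0  _ = refl
  triangle-closed 0 r1  h = ⊥-elim (from-no (3 ∣? 2) h)
  triangle-closed 0 r-1 h = ⊥-elim (from-no (3 ∣? 1) h)
  triangle-closed 1 r0  h = ⊥-elim (from-no (3 ∣? 1) h)
  triangle-closed 1 r1  _ = refl
  triangle-closed 1 r-1 h = ⊥-elim (from-no (3 ∣? 2) h)
  triangle-closed 2 r0  h = ⊥-elim (from-no (3 ∣? 2) h)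
  triangle-closed 2 r1  h = ⊥-elim (from-no (3 ∣? 4) h)
  triangle-closed 2 r-1 _ = refl
  triangle-closed (suc (suc (suc m))) d h = begin
    6 * (r₂ + (r₁ + (r₀ + T))) + (3 + m) + defect d ≡⟨ regroup r₀ r₁ r₂ T m (defect d) ⟩
    6 * (r₀ + r₁ + r₂) + (6 * T + m + defect d) + 3  ≡⟨ cong₂ (λ u v → 6 * u + v + 3) (rowCount-three m)
                                                                (triangle-closed m d (HasResidueℕ-3+ d h)) ⟩
    6 * suc m + m * m + 3                            ≡⟨ square m ⟩
    (3 + m) * (3 + m)                                ∎
    where
    open ≡-Reasoning
    r₀ r₁ r₂ T : ℕ
    r₀ = rowCount m
    r₁ = rowCount (1 + m)
    r₂ = rowCount (2 + m)
    T  = triangle m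
    regroup : ∀ r₀ r₁ r₂ T m δ →
              6 * (r₂ + (r₁ + (r₀ + T))) + (3 + m) + δ ≡ 6 * (r₀ + r₁ + r₂) + (6 * T + m + δ) + 3
    regroup = solve-∀
    square : ∀ m → 6 * suc m + m * m + 3 ≡ (3 + m) * (3 + m)
    square = solve-∀

open Rows

open import Data.Integer
  using (ℤ; +_; -_; _+_; _-_; _*_; _≤_; _<_; +≤+; +<+; 0ℤ; ∣_∣)
open import Data.Integer.Base using (positive; nonNegative)
open import Data.Integer.Properties
  using (i≤j⇒0≤j-i; 0≤i-j⇒j≤i; +-mono-≤; *-monoˡ-≤-nonNeg; *-cancelˡ-≤-pos; *-zeroʳ; +-identityʳ;
         <-irrefl; ≤∧≢⇒<; _≟_; i<j⇒suc[i]≤j; suc[i]≤j⇒i<j; pos-+; pos-*; +-injective; drop‿+≤+;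
         drop‿+<+; 0≤i⇒+∣i∣≡i; ≤-trans; neg-involutive; neg-mono-<; ∣-i∣≡∣i∣; _≤?_; ≰⇒>; <⇒≤;
         +-comm; *-cancelˡ-≡; ≤-refl; _<?_; ≮⇒≥)
open import Data.Integer.Divisibility using (_∣_)
open import Data.Integer.Divisibility.Signed
  using (divides; ∣ᵤ⇒∣; ∣⇒∣ᵤ; ∣m∣n⇒∣m+n; ∣m⇒∣-m; ∣n⇒∣m*n; ∣-refl)
  renaming (_∣_ to _∣ₛ_)
open import Data.Integer.Tactic.RingSolver using (solve-∀)
import Data.Nat as ℕ
open import Data.Nat using (z≤n)
import Data.Nat.Properties as ℕ
import Data.Nat.Divisibility as ℕ
open import Data.List using (List; map; length; _++_)
open import Data.List.Properties using (length-map; length-++)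
open import Data.List.Membership.Propositional using (_∈_)
open import Data.List.Membership.Propositional.Properties
  using (∈-map⁺; ∈-map⁻; ∈-++⁺ˡ; ∈-++⁺ʳ; ∈-++⁻)
open import Data.List.Relation.Unary.All using (All; []; _∷_)
import Data.List.Relation.Unary.All as All
open import Data.List.Relation.Unary.Unique.Propositional using (Unique)
import Data.List.Relation.Unary.Unique.Propositional.Properties as Unique
open import Data.Product using (Σ; _×_; _,_; proj₁; proj₂)
open import Data.Sum using (_⊎_; inj₁; inj₂)
open import Data.Empty using (⊥-elim)
open import Function.Bundles using (_⇔_; mk⇔; Equivalence)
import Function.Properties.Equivalence as ⇔
open import Relation.Nullary using (¬_; yes; no)
open import Relation.Nullary.Decidable using (from-no)
open import Relation.Binary.PropositionalEquality

nonNeg-+ : ∀ {i j} → 0ℤ ≤ i → 0ℤ ≤ j → 0ℤ ≤ i + j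
nonNeg-+ = +-mono-≤

nonNeg-* : ∀ {i j} → 0ℤ ≤ i → 0ℤ ≤ j → 0ℤ ≤ i * j
nonNeg-* {i} {j} 0≤i 0≤j =
  subst (_≤ i * j) (*-zeroʳ i) (*-monoˡ-≤-nonNeg i {{nonNegative 0≤i}} 0≤j)

pos-*-cancel : ∀ {i j} → 0ℤ < i → 0ℤ ≤ i * j → 0ℤ ≤ j
pos-*-cancel {i} {j} 0<i 0≤ij =
  *-cancelˡ-≤-pos 0ℤ j i {{positive 0<i}} (subst (_≤ i * j) (sym (*-zeroʳ i)) 0≤ij)

nonNeg⇒pos⊎zero : ∀ {i} → 0ℤ ≤ i → 0ℤ < i ⊎ i ≡ 0ℤ
nonNeg⇒pos⊎zero {i} 0≤i with i ≟ 0ℤ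
... | yes i≡0 = inj₂ i≡0
... | no  i≢0 = inj₁ (≤∧≢⇒< 0≤i (λ 0≡i → i≢0 (sym 0≡i)))

i<j⇒0≤j-i-1 : ∀ {i j} → i < j → 0ℤ ≤ j - i - + 1
i<j⇒0≤j-i-1 {i} {j} i<j = subst (0ℤ ≤_) (eq i j) (i≤j⇒0≤j-i (i<j⇒suc[i]≤j i<j))
  where
  eq : ∀ i j → j - (+ 1 + i) ≡ j - i - + 1
  eq = solve-∀

0≤j-i-1⇒i<j : ∀ {i j} → 0ℤ ≤ j - i - + 1 → i < j
0≤j-i-1⇒i<j {i} {j} h = suc[i]≤j⇒i<j (0≤i-j⇒j≤i (subst (0ℤ ≤_) (eq i j) h))
  where
  eq : ∀ i j → j - i - + 1 ≡ j - (+ 1 + i)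
  eq = solve-∀

≡-nonNeg : ∀ {i j} → i ≡ j → 0ℤ ≤ j → 0ℤ ≤ i
≡-nonNeg i≡j = subst (0ℤ ≤_) (sym i≡j)

¬0≤-1 : ¬ 0ℤ ≤ - + 1
¬0≤-1 ()

-- The bounding hexagon

InClosedHexagon : ℤ → ℤ → E → Set
InClosedHexagon a b (mkE x y) =
  (- a ≤ x × x ≤ b) × (- b ≤ y × y ≤ a) × (- b ≤ x - y × x - y ≤ a)

-- The component identities are stated with ⊗ and ⊕ unfolded: the ring solver does not
-- unfold definitions.
vertex₁ : ∀ a b → ι a ⊗ ω ⊕ ι b ≡ mkE b a
vertex₁ a b = cong₂ mkE (x a b) (y a b)
  where
  x : ∀ a b → a * + 0 - + 0 + b ≡ b
  x = solve-∀
  y : ∀ a b → a * + 1 + + 0 - + 0 + + 0 ≡ a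
  y = solve-∀

vertex₂ : ∀ a b → ⊝ (ι a ⊗ ω²) ⊖ ι b ≡ mkE (a - b) a
vertex₂ a b = cong₂ mkE (x a b) (y a b)
  where
  x : ∀ a b → - (a * - + 1 - + 0) - b ≡ a - b
  x = solve-∀
  y : ∀ a b → - (a * - + 1 + + 0 - + 0) - + 0 ≡ a
  y = solve-∀

vertex₃ : ∀ a b → ι a ⊗ ω² ⊕ ι b ⊗ ω ≡ mkE (- a) (b - a)
vertex₃ a b = cong₂ mkE (x a b) (y a b)
  where
  x : ∀ a b → a * - + 1 - + 0 + (b * + 0 - + 0) ≡ - a
  x = solve-∀
  y : ∀ a b → a * - + 1 + + 0 - + 0 + (b * + 1 + + 0 - + 0) ≡ b - a
  y = solve-∀

vertex₄ : ∀ a b → ⊝ (ι a) ⊖ ι b ⊗ ω ≡ mkE (- a) (- b)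
vertex₄ a b = cong₂ mkE (x a b) (y a b)
  where
  x : ∀ a b → - a - (b * + 0 - + 0) ≡ - a
  x = solve-∀
  y : ∀ a b → + 0 - (b * + 1 + + 0 - + 0) ≡ - b
  y = solve-∀

vertex₅ : ∀ a b → ι a ⊕ ι b ⊗ ω² ≡ mkE (a - b) (- b)
vertex₅ a b = cong₂ mkE (x a b) (y a b)
  where
  x : ∀ a b → a + (b * - + 1 - + 0) ≡ a - b
  x = solve-∀
  y : ∀ a b → + 0 + (b * - + 1 + + 0 - + 0) ≡ - b
  y = solve-∀

vertex₆ : ∀ a b → ⊝ (ι a ⊗ ω) ⊖ ι b ⊗ ω² ≡ mkE b (b - a)
vertex₆ a b = cong₂ mkE (x a b) (y a b)
  where
  x : ∀ a b → - (a * + 0 - + 0) - (b * - + 1 - + 0) ≡ b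
  x = solve-∀
  y : ∀ a b → - (a * + 1 + + 0 - + 0) - (b * - + 1 + + 0 - + 0) ≡ b - a
  y = solve-∀

bounding-hexagon-vertices : ∀ a b → InBoundingHexagon a b ≡
  InConvexHexagon (mkE b a) (mkE (a - b) a) (mkE (- a) (b - a))
                  (mkE (- a) (- b)) (mkE (a - b) (- b)) (mkE b (b - a))
bounding-hexagon-vertices a b = cong₆ InConvexHexagon
  (vertex₁ a b) (vertex₂ a b) (vertex₃ a b) (vertex₄ a b) (vertex₅ a b) (vertex₆ a b)
  where
  cong₆ : ∀ {A : Set} {B : Set₁} (f : A → A → A → A → A → A → B)
            {u₁ u₂ u₃ u₄ u₅ u₆ v₁ v₂ v₃ v₄ v₅ v₆} →
          u₁ ≡ v₁ → u₂ ≡ v₂ → u₃ ≡ v₃ → u₄ ≡ v₄ → u₅ ≡ v₅ → u₆ ≡ v₆ →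
          f u₁ u₂ u₃ u₄ u₅ u₆ ≡ f v₁ v₂ v₃ v₄ v₅ v₆
  cong₆ f refl refl refl refl refl refl = refl

EdgeSlacks : ℤ → ℤ → ℤ → ℤ → Set
EdgeSlacks a b x y =
  0ℤ ≤ (+ 2 * b - a) * (a - y) × 0ℤ ≤ (+ 2 * a - b) * (x - y - - b) ×
  0ℤ ≤ (+ 2 * b - a) * (x - - a) × 0ℤ ≤ (+ 2 * a - b) * (y - - b) ×
  0ℤ ≤ (+ 2 * b - a) * (a - (x - y)) × 0ℤ ≤ (+ 2 * a - b) * (b - x)

bounding-hexagon-edges : ∀ a b x y → InBoundingHexagon a b (mkE x y) ≡ EdgeSlacks a b x y
bounding-hexagon-edges a b x y =
  trans (cong (λ H → H (mkE x y)) (bounding-hexagon-vertices a b))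
        (cong₂ _×_ (cong (0ℤ ≤_) (edge₁ a b x y)) (cong₂ _×_ (cong (0ℤ ≤_) (edge₂ a b x y))
        (cong₂ _×_ (cong (0ℤ ≤_) (edge₃ a b x y)) (cong₂ _×_ (cong (0ℤ ≤_) (edge₄ a b x y))
        (cong₂ _×_ (cong (0ℤ ≤_) (edge₅ a b x y)) (cong (0ℤ ≤_) (edge₆ a b x y)))))))
  where
  edge₁ : ∀ a b x y → (a - b - b) * (y - a) - (a - a) * (x - b) ≡ (+ 2 * b - a) * (a - y)
  edge₁ = solve-∀
  edge₂ : ∀ a b x y → (- a - (a - b)) * (y - a) - (b - a - a) * (x - (a - b)) ≡ (+ 2 * a - b) * (x - y - - b)
  edge₂ = solve-∀
  edge₃ : ∀ a b x y → (- a - - a) * (y - (b - a)) - (- b - (b - a)) * (x - - a) ≡ (+ 2 * b - a) * (x - - a)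
  edge₃ = solve-∀
  edge₄ : ∀ a b x y → (a - b - - a) * (y - - b) - (- b - - b) * (x - - a) ≡ (+ 2 * a - b) * (y - - b)
  edge₄ = solve-∀
  edge₅ : ∀ a b x y → (b - (a - b)) * (y - - b) - (b - a - - b) * (x - (a - b)) ≡ (+ 2 * b - a) * (a - (x - y))
  edge₅ = solve-∀
  edge₆ : ∀ a b x y → (b - b) * (y - (b - a)) - (a - (b - a)) * (x - b) ≡ (+ 2 * a - b) * (b - x)
  edge₆ = solve-∀

edge-slacks⇔closed-hexagon : ∀ {a b x y} → 0ℤ ≤ + 2 * b - a → 0ℤ ≤ + 2 * a - b → 0ℤ < a + b →
  EdgeSlacks a b x y ⇔ InClosedHexagon a b (mkE x y)
edge-slacks⇔closed-hexagon {a} {b} {x} {y} 0≤s₁ 0≤s₂ 0<a+b = mk⇔ to from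
  where
  hexagon : 0ℤ ≤ a - y → 0ℤ ≤ x - y - - b → 0ℤ ≤ x - - a →
            0ℤ ≤ y - - b → 0ℤ ≤ a - (x - y) → 0ℤ ≤ b - x → InClosedHexagon a b (mkE x y)
  hexagon g₁ g₂ g₃ g₄ g₅ g₆ =
    (0≤i-j⇒j≤i g₃ , 0≤i-j⇒j≤i g₆) , (0≤i-j⇒j≤i g₄ , 0≤i-j⇒j≤i g₁) ,
    (0≤i-j⇒j≤i g₂ , 0≤i-j⇒j≤i g₅)

  -- If 2a - b = 0 (resp. 2b - a = 0) the even (resp. odd) edges have length zero and say
  -- nothing; their slacks are then sums of the slacks of the neighbouring edges.
  degenerate-edge : ∀ {g g₁ g₂ s} → g ≡ g₁ + g₂ - s → s ≡ 0ℤ → 0ℤ ≤ g₁ → 0ℤ ≤ g₂ → 0ℤ ≤ g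
  degenerate-edge {g₁ = g₁} {g₂} g≡ refl 0≤g₁ 0≤g₂ =
    subst (0ℤ ≤_) (sym (trans g≡ (+-identityʳ (g₁ + g₂)))) (nonNeg-+ 0≤g₁ 0≤g₂)

  to : EdgeSlacks a b x y → InClosedHexagon a b (mkE x y)
  to (e₁ , e₂ , e₃ , e₄ , e₅ , e₆) with nonNeg⇒pos⊎zero 0≤s₁ | nonNeg⇒pos⊎zero 0≤s₂
  ... | inj₁ 0<s₁ | inj₁ 0<s₂ =
    hexagon (pos-*-cancel 0<s₁ e₁) (pos-*-cancel 0<s₂ e₂) (pos-*-cancel 0<s₁ e₃)
            (pos-*-cancel 0<s₂ e₄) (pos-*-cancel 0<s₁ e₅) (pos-*-cancel 0<s₂ e₆)
  ... | inj₁ 0<s₁ | inj₂ s₂≡0 =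
    hexagon g₁ (degenerate-edge (r₂ a b x y) s₂≡0 g₃ g₁) g₃
            (degenerate-edge (r₄ a b x y) s₂≡0 g₃ g₅) g₅ (degenerate-edge (r₆ a b x y) s₂≡0 g₁ g₅)
    where
    g₁ : 0ℤ ≤ a - y
    g₁ = pos-*-cancel 0<s₁ e₁
    g₃ : 0ℤ ≤ x - - a
    g₃ = pos-*-cancel 0<s₁ e₃
    g₅ : 0ℤ ≤ a - (x - y)
    g₅ = pos-*-cancel 0<s₁ e₅
    r₂ : ∀ a b x y → x - y - - b ≡ (x - - a) + (a - y) - (+ 2 * a - b)
    r₂ = solve-∀
    r₄ : ∀ a b x y → y - - b ≡ (x - - a) + (a - (x - y)) - (+ 2 * a - b)
    r₄ = solve-∀
    r₆ : ∀ a b x y → b - x ≡ (a - y) + (a - (x - y)) - (+ 2 * a - b)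
    r₆ = solve-∀
  ... | inj₂ s₁≡0 | inj₁ 0<s₂ =
    hexagon (degenerate-edge (r₁ a b x y) s₁≡0 g₂ g₆) g₂
            (degenerate-edge (r₃ a b x y) s₁≡0 g₂ g₄) g₄ (degenerate-edge (r₅ a b x y) s₁≡0 g₄ g₆) g₆
    where
    g₂ : 0ℤ ≤ x - y - - b
    g₂ = pos-*-cancel 0<s₂ e₂
    g₄ : 0ℤ ≤ y - - b
    g₄ = pos-*-cancel 0<s₂ e₄
    g₆ : 0ℤ ≤ b - x
    g₆ = pos-*-cancel 0<s₂ e₆
    r₁ : ∀ a b x y → a - y ≡ (x - y - - b) + (b - x) - (+ 2 * b - a)
    r₁ = solve-∀
    r₃ : ∀ a b x y → x - - a ≡ (x - y - - b) + (y - - b) - (+ 2 * b - a)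
    r₃ = solve-∀
    r₅ : ∀ a b x y → a - (x - y) ≡ (y - - b) + (b - x) - (+ 2 * b - a)
    r₅ = solve-∀
  ... | inj₂ s₁≡0 | inj₂ s₂≡0 = ⊥-elim (<-irrefl refl (subst (0ℤ <_) a+b≡0 0<a+b))
    where
    sum : ∀ a b → a + b ≡ (+ 2 * b - a) + (+ 2 * a - b)
    sum = solve-∀
    a+b≡0 : a + b ≡ 0ℤ
    a+b≡0 = trans (sum a b) (cong₂ _+_ s₁≡0 s₂≡0)

  from : InClosedHexagon a b (mkE x y) → EdgeSlacks a b x y
  from ((h₃ , h₆) , (h₄ , h₁) , (h₂ , h₅)) =
    nonNeg-* 0≤s₁ (i≤j⇒0≤j-i h₁) , nonNeg-* 0≤s₂ (i≤j⇒0≤j-i h₂) ,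
    nonNeg-* 0≤s₁ (i≤j⇒0≤j-i h₃) , nonNeg-* 0≤s₂ (i≤j⇒0≤j-i h₄) ,
    nonNeg-* 0≤s₁ (i≤j⇒0≤j-i h₅) , nonNeg-* 0≤s₂ (i≤j⇒0≤j-i h₆)

inBoundingHexagon⇔ : ∀ {a b} → 0ℤ ≤ + 2 * b - a → 0ℤ ≤ + 2 * a - b → 0ℤ < a + b →
  ∀ p → InBoundingHexagon a b p ⇔ InClosedHexagon a b p
inBoundingHexagon⇔ {a} {b} 0≤s₁ 0≤s₂ 0<a+b (mkE x y) =
  subst (_⇔ InClosedHexagon a b (mkE x y)) (sym (bounding-hexagon-edges a b x y))
        (edge-slacks⇔closed-hexagon 0≤s₁ 0≤s₂ 0<a+b)

-- Cells and their centres

InOpenHexagon : ℤ → ℤ → E → Set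
InOpenHexagon a b (mkE x y) =
  (- a < x × x < b) × (- b < y × y < a) × (- b < x - y × x - y < a)

data UnitStep : ℤ → Set where
  down : UnitStep (- + 1)
  stay : UnitStep (+ 0)
  up   : UnitStep (+ 1)

<-step⇒≤ : ∀ {i j u} → i < j → UnitStep u → i ≤ j + u
<-step⇒≤ {i} {j} {u} i<j s = 0≤i-j⇒j≤i (subst (0ℤ ≤_) (eq i j u) (nonNeg-+ (i<j⇒0≤j-i-1 i<j) (1+u s)))
  where
  eq : ∀ i j u → j - i - + 1 + (u + + 1) ≡ j + u - i
  eq = solve-∀
  1+u : ∀ {u} → UnitStep u → 0ℤ ≤ u + + 1
  1+u down = +≤+ z≤n
  1+u stay = +≤+ z≤n
  1+u up   = +≤+ z≤n

step-<⇒≤ : ∀ {i j u} → UnitStep u → i < j → i + u ≤ j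
step-<⇒≤ {i} {j} {u} s i<j = 0≤i-j⇒j≤i (subst (0ℤ ≤_) (eq i j u) (nonNeg-+ (i<j⇒0≤j-i-1 i<j) (1-u s)))
  where
  eq : ∀ i j u → j - i - + 1 + (+ 1 - u) ≡ j - (i + u)
  eq = solve-∀
  1-u : ∀ {u} → UnitStep u → 0ℤ ≤ + 1 - u
  1-u down = +≤+ z≤n
  1-u stay = +≤+ z≤n
  1-u up   = +≤+ z≤n

≤-1⇒< : ∀ {i j} → i ≤ j - + 1 → i < j
≤-1⇒< {i} {j} h = 0≤j-i-1⇒i<j (subst (0ℤ ≤_) (eq i j) (i≤j⇒0≤j-i h))
  where
  eq : ∀ i j → j - + 1 - i ≡ j - i - + 1
  eq = solve-∀

+1≤⇒< : ∀ {i j} → i + + 1 ≤ j → i < j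
+1≤⇒< {i} {j} h = 0≤j-i-1⇒i<j (subst (0ℤ ≤_) (eq i j) (i≤j⇒0≤j-i h))
  where
  eq : ∀ i j → j - (i + + 1) ≡ j - i - + 1
  eq = solve-∀

corner-difference : ∀ x y u w → (x + u) - (y + w) ≡ (x - y) + (u - w)
corner-difference = solve-∀

open-hexagon⇒closed-corner : ∀ {a b x y u w} → UnitStep u → UnitStep w → UnitStep (u - w) →
  InOpenHexagon a b (mkE x y) → InClosedHexagon a b (mkE (x + u) (y + w))
open-hexagon⇒closed-corner {x = x} {y} {u} {w} su sw sd ((x₋ , x₊) , (y₋ , y₊) , (d₋ , d₊)) =
  (<-step⇒≤ x₋ su , step-<⇒≤ su x₊) , (<-step⇒≤ y₋ sw , step-<⇒≤ sw y₊) ,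
  (subst (_ ≤_) (sym (corner-difference x y u w)) (<-step⇒≤ d₋ sd) ,
   subst (_≤ _) (sym (corner-difference x y u w)) (step-<⇒≤ sd d₊))

closed-corners⇔open-hexagon : ∀ {a b} α → All (InClosedHexagon a b) (corners α) ⇔ InOpenHexagon a b α
closed-corners⇔open-hexagon {a} {b} (mkE x y) = mk⇔ to from
  where
  to : All (InClosedHexagon a b) (corners (mkE x y)) → InOpenHexagon a b (mkE x y)
  to (((_ , x+1≤b) , _ , (_ , x+1-y≤a)) ∷ ((-a≤x-1 , _) , _ , (-b≤x-1-y , _)) ∷
      (_ , (_ , y+1≤a) , _) ∷ (_ , (-b≤y-1 , _) , _) ∷ _ ∷ _ ∷ [])
    = (≤-1⇒< -a≤x-1 , +1≤⇒< x+1≤b) , (≤-1⇒< -b≤y-1 , +1≤⇒< y+1≤a) ,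
      (≤-1⇒< (subst (_ ≤_) (corner-difference x y (- + 1) (+ 0)) -b≤x-1-y) ,
       +1≤⇒< (subst (_≤ _) (corner-difference x y (+ 1) (+ 0)) x+1-y≤a))
  from : InOpenHexagon a b (mkE x y) → All (InClosedHexagon a b) (corners (mkE x y))
  from h = open-hexagon⇒closed-corner up stay up h ∷ open-hexagon⇒closed-corner down stay down h ∷
           open-hexagon⇒closed-corner stay up down h ∷ open-hexagon⇒closed-corner stay down up h ∷
           open-hexagon⇒closed-corner down down stay h ∷ open-hexagon⇒closed-corner up up stay h ∷ []
cellWithin⇔ : ∀ {a b} → 0ℤ ≤ + 2 * b - a → 0ℤ ≤ + 2 * a - b → 0ℤ < a + b →
  ∀ α → CellWithin a b α ⇔ InOpenHexagon a b α
cellWithin⇔ {a} {b} 0≤s₁ 0≤s₂ 0<a+b α = ⇔.trans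
  (mk⇔ (All.map (λ {p} → Equivalence.to (inBoundingHexagon⇔ 0≤s₁ 0≤s₂ 0<a+b p)))
       (All.map (λ {p} → Equivalence.from (inBoundingHexagon⇔ 0≤s₁ 0≤s₂ 0<a+b p))))
  (closed-corners⇔open-hexagon α)

inBenzel⇔ : ∀ {a b} → 0ℤ ≤ + 2 * b - a → 0ℤ ≤ + 2 * a - b → 0ℤ < a + b →
  ∀ α → InBenzel a b α ⇔ (InL (- + 1) α × InOpenHexagon a b α)
inBenzel⇔ 0≤s₁ 0≤s₂ 0<a+b α =
  mk⇔ (λ (inL , within) → inL , Equivalence.to (cellWithin⇔ 0≤s₁ 0≤s₂ 0<a+b α) within)
      (λ (inL , hexagon) → inL , Equivalence.from (cellWithin⇔ 0≤s₁ 0≤s₂ 0<a+b α) hexagon)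

⊝-involutive : ∀ α → ⊝ ⊝ α ≡ α
⊝-involutive (mkE x y) = cong₂ mkE (neg-involutive x) (neg-involutive y)

⊝-injective : ∀ {α β} → ⊝ α ≡ ⊝ β → α ≡ β
⊝-injective {α} {β} eq = trans (sym (⊝-involutive α)) (trans (cong ⊝_ eq) (⊝-involutive β))

InL-⊝ : ∀ {r} α → InL r α → InL (- r) (⊝ α)
InL-⊝ {r} (mkE x y) = subst (3 ℕ.∣_) (trans (sym (∣-i∣≡∣i∣ (x + y - r))) (cong ∣_∣ (negate x y r)))
  where
  negate : ∀ x y r → - (x + y - r) ≡ - x + - y - - r
  negate = solve-∀

<-neg : ∀ {i j} → - i < j → - j < i
<-neg {i} {j} -i<j = subst (- j <_) (neg-involutive i) (neg-mono-< -i<j)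

InOpenHexagon-⊝ : ∀ {a b} α → InOpenHexagon a b α → InOpenHexagon b a (⊝ α)
InOpenHexagon-⊝ (mkE x y) ((-a<x , x<b) , (-b<y , y<a) , (-b<x-y , x-y<a)) =
  (neg-mono-< x<b , <-neg -a<x) , (neg-mono-< y<a , <-neg -b<y) ,
  (subst (_ <_) (negate x y) (neg-mono-< x-y<a) , subst (_< _) (negate x y) (<-neg -b<x-y))
  where
  negate : ∀ x y → - (x - y) ≡ - x - - y
  negate = solve-∀

-- Residues modulo 3

HasResidue : ℤ → Residue → Set
HasResidue z d = + 3 ∣ z - residueℤ d

HasResidue⇒HasResidueℕ : ∀ n d → HasResidue (+ n) d → HasResidueℕ n d
HasResidue⇒HasResidueℕ n r0 h = subst (3 ℕ.∣_) (ℕ.+-identityʳ n) h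
HasResidue⇒HasResidueℕ ℕ.zero r1 h = ⊥-elim (from-no (3 ℕ.∣? 1) h)
HasResidue⇒HasResidueℕ (ℕ.suc n) r1 h = ℕ.∣m∣n⇒∣m+n ℕ.∣-refl h
HasResidue⇒HasResidueℕ n r-1 h = subst (3 ℕ.∣_) (ℕ.+-comm n 1) h

predᴿ negᴿ : Residue → Residue
predᴿ r0  = r-1
predᴿ r1  = r0
predᴿ r-1 = r1
negᴿ r0  = r0
negᴿ r1  = r-1
negᴿ r-1 = r1

3∣-by : ∀ {i j k} → i ≡ j + k → + 3 ∣ₛ j → + 3 ∣ₛ k → + 3 ∣ₛ i
3∣-by i≡j+k 3∣j 3∣k = subst (+ 3 ∣ₛ_) (sym i≡j+k) (∣m∣n⇒∣m+n 3∣j 3∣k)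

HasResidue-pred : ∀ {z} d → HasResidue z d → HasResidue (z - + 1) (predᴿ d)
HasResidue-pred {z} d h =
  ∣⇒∣ᵤ (3∣-by (split z (residueℤ d) (residueℤ (predᴿ d))) (∣ᵤ⇒∣ {i = z - residueℤ d} h) (gap d))
  where
  split : ∀ z r r′ → z - + 1 - r′ ≡ (z - r) + (r - + 1 - r′)
  split = solve-∀
  gap : ∀ d → + 3 ∣ₛ residueℤ d - + 1 - residueℤ (predᴿ d)
  gap r0  = divides (+ 0) refl
  gap r1  = divides (+ 0) refl
  gap r-1 = divides (- + 1) refl

HasResidue-2a-b : ∀ {a b} d → HasResidue (a + b) d → HasResidue (+ 2 * a - b) (negᴿ d)
HasResidue-2a-b {a} {b} d h =
  ∣⇒∣ᵤ (3∣-by (split a b (residueℤ d) (residueℤ (negᴿ d))) (∣n⇒∣m*n a ∣-refl)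
              (3∣-by refl (∣m⇒∣-m (∣ᵤ⇒∣ {i = a + b - residueℤ d} h)) (∣m⇒∣-m (sum d))))
  where
  split : ∀ a b r r′ → + 2 * a - b - r′ ≡ a * + 3 + (- (a + b - r) + - (r + r′))
  split = solve-∀
  sum : ∀ d → + 3 ∣ₛ residueℤ d + residueℤ (negᴿ d)
  sum r0  = divides (+ 0) refl
  sum r1  = divides (+ 0) refl
  sum r-1 = divides (+ 0) refl

triangleℤ : ℤ → ℤ
triangleℤ z = + triangle ∣ z ∣

triangleℤ-closed : ∀ {z} d → 0ℤ ≤ z → HasResidue z d → + 6 * triangleℤ z ≡ z * z - z - + defect d
triangleℤ-closed {+ n} d _ h = begin
  + 6 * + T                                         ≡⟨ isolate (+ 6 * + T) (+ n) (+ defect d) ⟩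
  + 6 * + T + + n + + defect d - + n - + defect d   ≡⟨ cong (λ v → v - + n - + defect d) ℤ-closed ⟩
  + n * + n - + n - + defect d                      ∎
  where
  open ≡-Reasoning
  T : ℕ.ℕ
  T = triangle n
  isolate : ∀ t n δ → t ≡ t + n + δ - n - δ
  isolate = solve-∀
  ℤ-closed : + 6 * + T + + n + + defect d ≡ + n * + n
  ℤ-closed = begin
    + 6 * + T + + n + + defect d     ≡⟨ cong (λ v → v + + n + + defect d) (sym (pos-* 6 T)) ⟩
    + (6 ℕ.* T) + + n + + defect d   ≡⟨ cong (_+ + defect d) (sym (pos-+ (6 ℕ.* T) n)) ⟩
    + (6 ℕ.* T ℕ.+ n) + + defect d   ≡⟨ sym (pos-+ (6 ℕ.* T ℕ.+ n) (defect d)) ⟩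
    + (6 ℕ.* T ℕ.+ n ℕ.+ defect d)   ≡⟨ cong +_ (triangle-closed n d (HasResidue⇒HasResidueℕ n d h)) ⟩
    + (n ℕ.* n)                       ≡⟨ pos-* n n ⟩
    + n * + n                        ∎

-- Counting centres row by row

InTrapezoid : ℤ → ℤ → ℤ → ℤ → Set
InTrapezoid lo hi ℓ t = lo ≤ ℓ × ℓ < hi × 0ℤ ≤ t × t < ℓ

lower-half⇔trapezoid : ∀ {a b m x y} → m < a → m ≤ b - a →
  (InOpenHexagon a b (mkE x y) × y ≤ m) ⇔
  InTrapezoid (+ 2 * a - b) (m + + 2 * a) (y + + 2 * a - + 1) (x + a - + 1)
lower-half⇔trapezoid {a} {b} {m} {x} {y} m<a m≤b-a = mk⇔ to from
  where
  h₁ : 0ℤ ≤ a - m - + 1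
  h₁ = i<j⇒0≤j-i-1 m<a
  h₂ : 0ℤ ≤ b - a - m
  h₂ = i≤j⇒0≤j-i m≤b-a
  to : InOpenHexagon a b (mkE x y) × y ≤ m →
       InTrapezoid (+ 2 * a - b) (m + + 2 * a) (y + + 2 * a - + 1) (x + a - + 1)
  to (((-a<x , _) , (-b<y , _) , (_ , x-y<a)) , y≤m) =
    0≤i-j⇒j≤i (≡-nonNeg (e₁ a b y) (i<j⇒0≤j-i-1 -b<y)) ,
    0≤j-i-1⇒i<j (≡-nonNeg (e₂ a m y) (i≤j⇒0≤j-i y≤m)) ,
    ≡-nonNeg (e₃ a x) (i<j⇒0≤j-i-1 -a<x) ,
    0≤j-i-1⇒i<j (≡-nonNeg (e₄ a x y) (i<j⇒0≤j-i-1 x-y<a))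
    where
    e₁ : ∀ a b y → y + + 2 * a - + 1 - (+ 2 * a - b) ≡ y - - b - + 1
    e₁ = solve-∀
    e₂ : ∀ a m y → m + + 2 * a - (y + + 2 * a - + 1) - + 1 ≡ m - y
    e₂ = solve-∀
    e₃ : ∀ a x → x + a - + 1 ≡ x - - a - + 1
    e₃ = solve-∀
    e₄ : ∀ a x y → y + + 2 * a - + 1 - (x + a - + 1) - + 1 ≡ a - (x - y) - + 1
    e₄ = solve-∀
  from : InTrapezoid (+ 2 * a - b) (m + + 2 * a) (y + + 2 * a - + 1) (x + a - + 1) →
         InOpenHexagon a b (mkE x y) × y ≤ m
  from (lo≤ℓ , ℓ<hi , 0≤t , t<ℓ) =
    ((0≤j-i-1⇒i<j (≡-nonNeg (e₁ a x) 0≤t) ,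
      0≤j-i-1⇒i<j (≡-nonNeg (e₂ a b m x y) (nonNeg-+ (nonNeg-+ σ₄ σ₂) h₂))) ,
     (0≤j-i-1⇒i<j (≡-nonNeg (e₃ a b y) σ₁) ,
      0≤j-i-1⇒i<j (≡-nonNeg (e₄ a m y) (nonNeg-+ σ₂ h₁))) ,
     (0≤j-i-1⇒i<j (≡-nonNeg (e₅ a b m x y) (nonNeg-+ (nonNeg-+ 0≤t σ₂) h₂)) ,
      0≤j-i-1⇒i<j (≡-nonNeg (e₆ a x y) σ₄))) ,
    0≤i-j⇒j≤i σ₂
    where
    e₇ : ∀ a m y → m - y ≡ m + + 2 * a - (y + + 2 * a - + 1) - + 1
    e₇ = solve-∀
    σ₁ : 0ℤ ≤ y + + 2 * a - + 1 - (+ 2 * a - b)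
    σ₁ = i≤j⇒0≤j-i lo≤ℓ
    σ₂ : 0ℤ ≤ m - y
    σ₂ = ≡-nonNeg (e₇ a m y) (i<j⇒0≤j-i-1 ℓ<hi)
    σ₄ : 0ℤ ≤ y + + 2 * a - + 1 - (x + a - + 1) - + 1
    σ₄ = i<j⇒0≤j-i-1 t<ℓ
    e₁ : ∀ a x → x - - a - + 1 ≡ x + a - + 1
    e₁ = solve-∀
    e₂ : ∀ a b m x y → b - x - + 1 ≡ (y + + 2 * a - + 1 - (x + a - + 1) - + 1) + (m - y) + (b - a - m)
    e₂ = solve-∀
    e₃ : ∀ a b y → y - - b - + 1 ≡ y + + 2 * a - + 1 - (+ 2 * a - b)
    e₃ = solve-∀
    e₄ : ∀ a m y → a - y - + 1 ≡ (m - y) + (a - m - + 1)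
    e₄ = solve-∀
    e₅ : ∀ a b m x y → x - y - - b - + 1 ≡ (x + a - + 1) + (m - y) + (b - a - m)
    e₅ = solve-∀
    e₆ : ∀ a x y → a - (x - y) - + 1 ≡ y + + 2 * a - + 1 - (x + a - + 1) - + 1
    e₆ = solve-∀

∈-rows⇔trapezoid : ∀ {s lo k ℓ t} →
  (ℓ , t) ∈ rows s lo k ⇔ (InTrapezoid (+ lo) (+ (lo ℕ.+ k)) (+ ℓ) (+ t) × 3 ℕ.∣ t ℕ.+ ℓ ℕ.+ s)
∈-rows⇔trapezoid {s} {lo} {k} {ℓ} {t} = mk⇔ to from
  where
  to : (ℓ , t) ∈ rows s lo k → InTrapezoid (+ lo) (+ (lo ℕ.+ k)) (+ ℓ) (+ t) × 3 ℕ.∣ t ℕ.+ ℓ ℕ.+ s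
  to p with Equivalence.to ∈-rows p
  ... | lo≤ℓ , ℓ<hi , t∈ with Equivalence.to ∈-row t∈
  ...   | t<ℓ , 3∣ = (+≤+ lo≤ℓ , +<+ ℓ<hi , +≤+ ℕ.z≤n , +<+ t<ℓ) , 3∣
  from : InTrapezoid (+ lo) (+ (lo ℕ.+ k)) (+ ℓ) (+ t) × 3 ℕ.∣ t ℕ.+ ℓ ℕ.+ s → (ℓ , t) ∈ rows s lo k
  from ((lo≤ℓ , ℓ<hi , _ , t<ℓ) , 3∣) =
    Equivalence.from ∈-rows
      (drop‿+≤+ lo≤ℓ , drop‿+<+ ℓ<hi , Equivalence.from ∈-row (drop‿+<+ t<ℓ , 3∣))

-- The t-th point, from the left, of the row y = ℓ + 1 - 2a, which has length ℓ in the
-- lower part of the hexagon; its class is t + ℓ + 2 modulo 3.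
centre : ℤ → ℕ.ℕ × ℕ.ℕ → E
centre a (ℓ , t) = mkE (+ t + + 1 - a) (+ ℓ + + 1 - + 2 * a)

centre-injective : ∀ a {p q} → centre a p ≡ centre a q → p ≡ q
centre-injective a {ℓ , t} {ℓ′ , t′} eq =
  cong₂ _,_ (+-injective (recover (+ 2 * a) (cong E.im eq))) (+-injective (recover a (cong E.re eq)))
  where
  shift : ∀ u c → u ≡ u + + 1 - c - + 1 + c
  shift = solve-∀
  recover : ∀ {u u′} c → u + + 1 - c ≡ u′ + + 1 - c → u ≡ u′
  recover {u} {u′} c e = trans (shift u c) (trans (cong (λ v → v - + 1 + c) e) (sym (shift u′ c)))

centre-class : ∀ {s r} a ℓ t → + 3 ∣ₛ + s + r - + 2 → 3 ℕ.∣ t ℕ.+ ℓ ℕ.+ s ⇔ InL r (centre a (ℓ , t))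
centre-class {s} {r} a ℓ t 3∣s+r-2 = mk⇔ to from
  where
  expand : + (t ℕ.+ ℓ ℕ.+ s) ≡ + t + + ℓ + + s
  expand = trans (pos-+ (t ℕ.+ ℓ) s) (cong (_+ + s) (pos-+ t ℓ))
  split : ∀ t ℓ s a r → t + + 1 - a + (ℓ + + 1 - + 2 * a) - r ≡ (t + ℓ + s) + (- (s + r - + 2) + (- a) * + 3)
  split = solve-∀
  merge : ∀ t ℓ s a r → t + ℓ + s ≡ (t + + 1 - a + (ℓ + + 1 - + 2 * a) - r) + ((s + r - + 2) + a * + 3)
  merge = solve-∀
  to : 3 ℕ.∣ t ℕ.+ ℓ ℕ.+ s → InL r (centre a (ℓ , t))
  to 3∣ = ∣⇒∣ᵤ (3∣-by (split (+ t) (+ ℓ) (+ s) a r)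
                       (subst (+ 3 ∣ₛ_) expand (∣ᵤ⇒∣ {i = + (t ℕ.+ ℓ ℕ.+ s)} 3∣))
                       (3∣-by refl (∣m⇒∣-m 3∣s+r-2) (∣n⇒∣m*n (- a) ∣-refl)))
  from : InL r (centre a (ℓ , t)) → 3 ℕ.∣ t ℕ.+ ℓ ℕ.+ s
  from 3∣ = ∣⇒∣ᵤ (subst (+ 3 ∣ₛ_) (sym expand)
                  (3∣-by (merge (+ t) (+ ℓ) (+ s) a r)
                         (∣ᵤ⇒∣ {i = + t + + 1 - a + (+ ℓ + + 1 - + 2 * a) - r} 3∣)
                         (3∣-by refl 3∣s+r-2 (∣n⇒∣m*n a ∣-refl))))

InTrapezoid-cong : ∀ {lo lo′ hi hi′ ℓ ℓ′ t t′} → lo ≡ lo′ → hi ≡ hi′ → ℓ ≡ ℓ′ → t ≡ t′ →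
  InTrapezoid lo hi ℓ t → InTrapezoid lo′ hi′ ℓ′ t′
InTrapezoid-cong refl refl refl refl h = h

lower-centres : ∀ {a b m s r} → s ℕ.< 2 → + 3 ∣ₛ + s + r - + 2 →
  b ≤ + 2 * a → m < a → m ≤ b - a → - b ≤ m →
  Σ (List E) λ cells → Unique cells ×
    (∀ α → α ∈ cells ⇔ (InL r α × InOpenHexagon a b α × E.im α ≤ m)) ×
    (+ length cells ≡ triangleℤ (m + + 2 * a) - triangleℤ (+ 2 * a - b))
lower-centres {a} {b} {m} {s} {r} s<2 3∣s+r-2 b≤2a m<a m≤b-a -b≤m =
  map (centre a) (rows s lo k) , Unique.map⁺ (centre-injective a) (rows-unique s lo k) ,
  (λ α → mk⇔ to (from α)) , size
  where
  lo k : ℕ.ℕ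
  lo = ∣ + 2 * a - b ∣
  k  = ∣ m + b ∣
  0≤lo : 0ℤ ≤ + 2 * a - b
  0≤lo = i≤j⇒0≤j-i b≤2a
  lo≡ : + lo ≡ + 2 * a - b
  lo≡ = 0≤i⇒+∣i∣≡i 0≤lo
  hi≡ : + (lo ℕ.+ k) ≡ m + + 2 * a
  hi≡ = trans (pos-+ lo k)
              (trans (cong₂ _+_ lo≡ (0≤i⇒+∣i∣≡i (≡-nonNeg (e₁ m b) (i≤j⇒0≤j-i -b≤m)))) (e₂ a b m))
    where
    e₁ : ∀ m b → m + b ≡ m - - b
    e₁ = solve-∀
    e₂ : ∀ a b m → + 2 * a - b + (m + b) ≡ m + + 2 * a
    e₂ = solve-∀
  coordinates : ∀ u c → u ≡ u + + 1 - c + c - + 1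
  coordinates = solve-∀

  to : ∀ {α} → α ∈ map (centre a) (rows s lo k) → InL r α × InOpenHexagon a b α × E.im α ≤ m
  to α∈ with ∈-map⁻ (centre a) α∈
  ... | (ℓ , t) , p∈ , refl with Equivalence.to ∈-rows⇔trapezoid p∈
  ...   | trapezoid , 3∣ =
    Equivalence.to (centre-class a ℓ t 3∣s+r-2) 3∣ ,
    Equivalence.from (lower-half⇔trapezoid m<a m≤b-a)
      (InTrapezoid-cong lo≡ hi≡ (coordinates (+ ℓ) (+ 2 * a)) (coordinates (+ t) a) trapezoid)

  from : ∀ α → InL r α × InOpenHexagon a b α × E.im α ≤ m → α ∈ map (centre a) (rows s lo k)
  from (mkE x y) (inL , hexagon , y≤m) =
    subst (_∈ map (centre a) (rows s lo k)) (sym α≡) (∈-map⁺ (centre a) (Equivalence.from ∈-rows⇔trapezoid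
      (InTrapezoid-cong (sym lo≡) (sym hi≡) (sym ℓ≡) (sym t≡) trapezoid ,
       Equivalence.from (centre-class a ℓ t 3∣s+r-2) (subst (InL r) α≡ inL))))
    where
    trapezoid : InTrapezoid (+ 2 * a - b) (m + + 2 * a) (y + + 2 * a - + 1) (x + a - + 1)
    trapezoid = Equivalence.to (lower-half⇔trapezoid m<a m≤b-a) (hexagon , y≤m)
    t ℓ : ℕ.ℕ
    t = ∣ x + a - + 1 ∣
    ℓ = ∣ y + + 2 * a - + 1 ∣
    t≡ : + t ≡ x + a - + 1
    t≡ = 0≤i⇒+∣i∣≡i (proj₁ (proj₂ (proj₂ trapezoid)))
    ℓ≡ : + ℓ ≡ y + + 2 * a - + 1
    ℓ≡ = 0≤i⇒+∣i∣≡i (≤-trans 0≤lo (proj₁ trapezoid))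
    back : ∀ u c → u ≡ u + c - + 1 + + 1 - c
    back = solve-∀
    α≡ : mkE x y ≡ centre a (ℓ , t)
    α≡ = cong₂ mkE (trans (back x a) (cong (λ v → v + + 1 - a) (sym t≡)))
                   (trans (back y (+ 2 * a)) (cong (λ v → v + + 1 - + 2 * a) (sym ℓ≡)))

  size : + length (map (centre a) (rows s lo k)) ≡ triangleℤ (m + + 2 * a) - triangleℤ (+ 2 * a - b)
  size = begin
    + length (map (centre a) (rows s lo k))       ≡⟨ cong +_ (length-map (centre a) (rows s lo k)) ⟩
    + L                                         ≡⟨ isolate (+ L) (+ triangle lo) ⟩
    + L + + triangle lo - + triangle lo ≡⟨ cong (_- + triangle lo) (sym (pos-+ L (triangle lo))) ⟩
    + (L ℕ.+ triangle lo) - + triangle lo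
      ≡⟨ cong (λ n → + n - + triangle lo) (length-rows s<2 lo k) ⟩
    + triangle (lo ℕ.+ k) - + triangle lo
      ≡⟨ cong (λ n → + triangle n - + triangle lo) (cong ∣_∣ hi≡) ⟩
    triangleℤ (m + + 2 * a) - triangleℤ (+ 2 * a - b)   ∎
    where
    open ≡-Reasoning
    L : ℕ.ℕ
    L = length (rows s lo k)
    isolate : ∀ u v → u ≡ u + v - v
    isolate = solve-∀

benzel-centres : ∀ {a b m} → b ≤ + 2 * a → a ≤ + 2 * b →
  - b ≤ m → m < a → b - a - + 1 ≤ m → m ≤ b - a →
  Σ (List E) λ cells → Unique cells ×
    (∀ α → α ∈ cells ⇔ (InL (- + 1) α × InOpenHexagon a b α)) ×
    (+ length cells ≡
     triangleℤ (m + + 2 * a) + triangleℤ (+ 2 * b - + 1 - m) - triangleℤ (+ 2 * a - b) - triangleℤ (+ 2 * b - a))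
benzel-centres {a} {b} {m} b≤2a a≤2b -b≤m m<a b-a-1≤m m≤b-a
  with lower-centres {m = m} {s = 0} {r = - + 1} (ℕ.s≤s ℕ.z≤n) (divides (- + 1) refl) b≤2a m<a m≤b-a -b≤m
     -- the reflection of the upper part
     | lower-centres {m = - m - + 1} {s = 1} {r = + 1} (ℕ.s≤s (ℕ.s≤s ℕ.z≤n)) (divides (+ 0) refl) a≤2b
         (0≤j-i-1⇒i<j (≡-nonNeg (e₁ b m) (i≤j⇒0≤j-i -b≤m)))
         (0≤i-j⇒j≤i (≡-nonNeg (e₂ a b m) (i≤j⇒0≤j-i b-a-1≤m)))
         (0≤i-j⇒j≤i (≡-nonNeg (e₃ a m) (i<j⇒0≤j-i-1 m<a)))
  where
  e₁ : ∀ b m → b - (- m - + 1) - + 1 ≡ m - - b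
  e₁ = solve-∀
  e₂ : ∀ a b m → a - b - (- m - + 1) ≡ m - (b - a - + 1)
  e₂ = solve-∀
  e₃ : ∀ a m → - m - + 1 - - a ≡ a - m - + 1
  e₃ = solve-∀
... | cells₁ , unique₁ , members₁ , size₁ | cells₂ , unique₂ , members₂ , size₂ =
  cells₁ ++ map ⊝_ cells₂ ,
  Unique.++⁺ unique₁ (Unique.map⁺ ⊝-injective unique₂) disjoint ,
  (λ α → mk⇔ to (from α)) ,
  size
  where
  disjoint : ∀ {α} → ¬ (α ∈ cells₁ × α ∈ map ⊝_ cells₂)
  disjoint (α∈₁ , α∈₂) with ∈-map⁻ ⊝_ α∈₂
  ... | β , β∈ , refl with Equivalence.to (members₁ (⊝ β)) α∈₁ | Equivalence.to (members₂ β) β∈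
  ...   | _ , _ , -y≤m | _ , _ , y≤-m-1 =
    ¬0≤-1 (≡-nonNeg (gap m (E.im β)) (nonNeg-+ (i≤j⇒0≤j-i -y≤m) (i≤j⇒0≤j-i y≤-m-1)))
    where
    gap : ∀ m y → - + 1 ≡ (m - - y) + (- m - + 1 - y)
    gap = solve-∀

  to : ∀ {α} → α ∈ cells₁ ++ map ⊝_ cells₂ → InL (- + 1) α × InOpenHexagon a b α
  to {α} α∈ with ∈-++⁻ cells₁ α∈
  ... | inj₁ α∈₁ with Equivalence.to (members₁ α) α∈₁
  ...   | inL , hexagon , _ = inL , hexagon
  to {α} α∈ | inj₂ α∈₂ with ∈-map⁻ ⊝_ α∈₂
  ...   | β , β∈ , refl with Equivalence.to (members₂ β) β∈
  ...     | inL , hexagon , _ = InL-⊝ β inL , InOpenHexagon-⊝ β hexagon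

  from : ∀ α → InL (- + 1) α × InOpenHexagon a b α → α ∈ cells₁ ++ map ⊝_ cells₂
  from α (inL , hexagon) with E.im α ≤? m
  ... | yes y≤m = ∈-++⁺ˡ (Equivalence.from (members₁ α) (inL , hexagon , y≤m))
  ... | no  y≰m = ∈-++⁺ʳ cells₁ (subst (_∈ map ⊝_ cells₂) (⊝-involutive α) (∈-map⁺ ⊝_
        (Equivalence.from (members₂ (⊝ α)) (InL-⊝ {r = - + 1} α inL , InOpenHexagon-⊝ α hexagon , -y≤-m-1))))
    where
    flip : ∀ m y → - m - (- y) - + 1 ≡ - m - + 1 - - y
    flip = solve-∀
    -y≤-m-1 : - E.im α ≤ - m - + 1
    -y≤-m-1 = 0≤i-j⇒j≤i (≡-nonNeg (sym (flip m (E.im α))) (i<j⇒0≤j-i-1 (neg-mono-< (≰⇒> y≰m))))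

  size : + length (cells₁ ++ map ⊝_ cells₂) ≡
         triangleℤ (m + + 2 * a) + triangleℤ (+ 2 * b - + 1 - m) - triangleℤ (+ 2 * a - b) - triangleℤ (+ 2 * b - a)
  size = begin
    + length (cells₁ ++ map ⊝_ cells₂)
      ≡⟨ cong +_ (trans (length-++ cells₁) (cong (length cells₁ ℕ.+_) (length-map ⊝_ cells₂))) ⟩
    + (length cells₁ ℕ.+ length cells₂)
      ≡⟨ pos-+ (length cells₁) (length cells₂) ⟩
    + length cells₁ + + length cells₂
      ≡⟨ cong₂ _+_ size₁ (trans size₂ (cong (λ z → triangleℤ z - triangleℤ (+ 2 * b - a)) (e b m))) ⟩
    triangleℤ (m + + 2 * a) - triangleℤ (+ 2 * a - b) + (triangleℤ (+ 2 * b - + 1 - m) - triangleℤ (+ 2 * b - a))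
      ≡⟨ regroup (triangleℤ (m + + 2 * a)) (triangleℤ (+ 2 * b - + 1 - m))
                 (triangleℤ (+ 2 * a - b)) (triangleℤ (+ 2 * b - a)) ⟩
    triangleℤ (m + + 2 * a) + triangleℤ (+ 2 * b - + 1 - m) - triangleℤ (+ 2 * a - b) - triangleℤ (+ 2 * b - a) ∎
    where
    open ≡-Reasoning
    e : ∀ b m → - m - + 1 + + 2 * b ≡ + 2 * b - + 1 - m
    e = solve-∀
    regroup : ∀ c₁ c₂ c₃ c₄ → c₁ - c₃ + (c₂ - c₄) ≡ c₁ + c₂ - c₃ - c₄
    regroup = solve-∀

-- When a = 2b the row y = b - a - 1 lies below the hexagon, so the cut is moved one row up.
dividing-row : ∀ {a b} → + 2 ≤ b → b ≤ + 2 * a → a ≤ + 2 * b →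
  Σ ℤ λ m → (- b ≤ m × m < a × b - a - + 1 ≤ m × m ≤ b - a) ×
            triangleℤ (m + + 2 * a) + triangleℤ (+ 2 * b - + 1 - m) ≡ triangleℤ (a + b - + 1) + triangleℤ (a + b)
dividing-row {a} {b} 2≤b b≤2a a≤2b with a <? + 2 * b
... | yes a<2b =
  b - a - + 1 ,
  (0≤i-j⇒j≤i (≡-nonNeg (e₁ a b) (i<j⇒0≤j-i-1 a<2b)) ,
   0≤j-i-1⇒i<j (≡-nonNeg (e₂ a b) (i≤j⇒0≤j-i b≤2a)) ,
   ≤-refl ,
   0≤i-j⇒j≤i (≡-nonNeg (e₃ a b) (+≤+ ℕ.z≤n))) ,
  cong₂ _+_ (cong triangleℤ (e₄ a b)) (cong triangleℤ (e₅ a b))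
  where
  e₁ : ∀ a b → b - a - + 1 - - b ≡ + 2 * b - a - + 1
  e₁ = solve-∀
  e₂ : ∀ a b → a - (b - a - + 1) - + 1 ≡ + 2 * a - b
  e₂ = solve-∀
  e₃ : ∀ a b → b - a - (b - a - + 1) ≡ + 1
  e₃ = solve-∀
  e₄ : ∀ a b → b - a - + 1 + + 2 * a ≡ a + b - + 1
  e₄ = solve-∀
  e₅ : ∀ a b → + 2 * b - + 1 - (b - a - + 1) ≡ a + b
  e₅ = solve-∀
... | no a≮2b =
  b - a ,
  (0≤i-j⇒j≤i (≡-nonNeg (e₁ a b) (i≤j⇒0≤j-i a≤2b)) ,
   0≤j-i-1⇒i<j (≡-nonNeg (e₂ a b)
     (nonNeg-+ (nonNeg-+ (nonNeg-+ σ σ) (nonNeg-+ (nonNeg-+ τ τ) τ)) (+≤+ ℕ.z≤n))) ,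
   0≤i-j⇒j≤i (≡-nonNeg (e₃ a b) (+≤+ ℕ.z≤n)) ,
   ≤-refl) ,
  trans (cong₂ _+_ (cong triangleℤ (e₄ a b)) (cong triangleℤ (e₅ a b)))
        (+-comm (triangleℤ (a + b)) (triangleℤ (a + b - + 1)))
  where
  σ : 0ℤ ≤ a - + 2 * b
  σ = i≤j⇒0≤j-i (≮⇒≥ a≮2b)
  τ : 0ℤ ≤ b - + 2
  τ = i≤j⇒0≤j-i 2≤b
  e₁ : ∀ a b → b - a - - b ≡ + 2 * b - a
  e₁ = solve-∀
  e₂ : ∀ a b → a - (b - a) - + 1 ≡ (a - + 2 * b) + (a - + 2 * b) + ((b - + 2) + (b - + 2) + (b - + 2)) + + 5
  e₂ = solve-∀
  e₃ : ∀ a b → b - a - (b - a - + 1) ≡ + 1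
  e₃ = solve-∀
  e₄ : ∀ a b → b - a + + 2 * a ≡ a + b
  e₄ = solve-∀
  e₅ : ∀ a b → + 2 * b - + 1 - (b - a) ≡ a + b - + 1
  e₅ = solve-∀

area-polynomial : ∀ c a b →
  (a + b - + 1) * (a + b - + 1) - (a + b - + 1) - + defect (predᴿ c) +
  ((a + b) * (a + b) - (a + b) - + defect c) -
  ((+ 2 * a - b) * (+ 2 * a - b) - (+ 2 * a - b) - + defect (negᴿ c)) -
  ((+ 2 * b - a) * (+ 2 * b - a) - (+ 2 * b - a) - + defect (negᴿ c))
  ≡ + 3 * twiceArea a b c
area-polynomial r0 = identity
  where
  identity : ∀ a b →
    (a + b - + 1) * (a + b - + 1) - (a + b - + 1) - + 2 + ((a + b) * (a + b) - (a + b) - + 0) -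
    ((+ 2 * a - b) * (+ 2 * a - b) - (+ 2 * a - b) - + 0) - ((+ 2 * b - a) * (+ 2 * b - a) - (+ 2 * b - a) - + 0)
    ≡ + 3 * (- (a * a) + + 4 * a * b - b * b - a - b)
  identity = solve-∀
area-polynomial r1 = identity
  where
  identity : ∀ a b →
    (a + b - + 1) * (a + b - + 1) - (a + b - + 1) - + 0 + ((a + b) * (a + b) - (a + b) - + 0) -
    ((+ 2 * a - b) * (+ 2 * a - b) - (+ 2 * a - b) - + 2) - ((+ 2 * b - a) * (+ 2 * b - a) - (+ 2 * b - a) - + 2)
    ≡ + 3 * (- (a * a) + + 4 * a * b - b * b - a - b + + 2)
  identity = solve-∀
area-polynomial r-1 = identity
  where
  identity : ∀ a b →
    (a + b - + 1) * (a + b - + 1) - (a + b - + 1) - + 0 + ((a + b) * (a + b) - (a + b) - + 2) -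
    ((+ 2 * a - b) * (+ 2 * a - b) - (+ 2 * a - b) - + 0) - ((+ 2 * b - a) * (+ 2 * b - a) - (+ 2 * b - a) - + 0)
    ≡ + 3 * (- (a * a) + + 4 * a * b - b * b - a - b)
  identity = solve-∀

twice-area : ∀ {a b} c → HasResidue (a + b) c → 0ℤ < a + b → 0ℤ ≤ + 2 * a - b → 0ℤ ≤ + 2 * b - a →
  + 2 * (triangleℤ (a + b - + 1) + triangleℤ (a + b) - triangleℤ (+ 2 * a - b) - triangleℤ (+ 2 * b - a)) ≡
  twiceArea a b c
twice-area {a} {b} c a+b≡c 0<a+b 0≤2a-b 0≤2b-a = *-cancelˡ-≡ (+ 3) _ _ (begin
  + 3 * (+ 2 * (C₁ + C₂ - C₃ - C₄))           ≡⟨ distribute C₁ C₂ C₃ C₄ ⟩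
  + 6 * C₁ + + 6 * C₂ - + 6 * C₃ - + 6 * C₄  ≡⟨ cong₂ _-_ (cong₂ _-_ (cong₂ _+_
      (triangleℤ-closed (predᴿ c) (≡-nonNeg (e a b) (i<j⇒0≤j-i-1 0<a+b)) (HasResidue-pred {a + b} c a+b≡c))
      (triangleℤ-closed c (<⇒≤ 0<a+b) a+b≡c))
      (triangleℤ-closed (negᴿ c) 0≤2a-b (HasResidue-2a-b {a} {b} c a+b≡c)))
      (triangleℤ-closed (negᴿ c) 0≤2b-a
        (HasResidue-2a-b {b} {a} c (subst (λ z → HasResidue z c) (+-comm a b) a+b≡c))) ⟩
  _                                           ≡⟨ area-polynomial c a b ⟩
  + 3 * twiceArea a b c                       ∎)
  where
  open ≡-Reasoning
  C₁ C₂ C₃ C₄ : ℤ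
  C₁ = triangleℤ (a + b - + 1)
  C₂ = triangleℤ (a + b)
  C₃ = triangleℤ (+ 2 * a - b)
  C₄ = triangleℤ (+ 2 * b - a)
  distribute : ∀ c₁ c₂ c₃ c₄ →
               + 3 * (+ 2 * (c₁ + c₂ - c₃ - c₄)) ≡ + 6 * c₁ + + 6 * c₂ - + 6 * c₃ - + 6 * c₄
  distribute = solve-∀
  e : ∀ a b → a + b - + 1 ≡ a + b - 0ℤ - + 1
  e = solve-∀

theorem1 : (a b : ℤ) → + 2 ≤ a → a ≤ + 2 * b → + 2 ≤ b → b ≤ + 2 * a →
    (c : Residue) → IsClass a b c →
    Σ (List E) λ cells →
      Unique cells × (∀ α → (α ∈ cells) ⇔ InBenzel a b α) ×
      (+ 2 * + length cells ≡ twiceArea a b c)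
theorem1 a b 2≤a a≤2b 2≤b b≤2a c class with dividing-row 2≤b b≤2a a≤2b
... | m , (-b≤m , m<a , b-a-1≤m , m≤b-a) , counts with benzel-centres b≤2a a≤2b -b≤m m<a b-a-1≤m m≤b-a
... | cells , unique , members , size =
  cells , unique , (λ α → ⇔.trans (members α) (⇔.sym (inBenzel⇔ 0≤2b-a 0≤2a-b 0<a+b α))) , (begin
    + 2 * + length cells
      ≡⟨ cong (+ 2 *_) size ⟩
    + 2 * (triangleℤ (m + + 2 * a) + triangleℤ (+ 2 * b - + 1 - m) - triangleℤ (+ 2 * a - b) - triangleℤ (+ 2 * b - a))
      ≡⟨ cong (λ z → + 2 * (z - triangleℤ (+ 2 * a - b) - triangleℤ (+ 2 * b - a))) counts ⟩
    + 2 * (triangleℤ (a + b - + 1) + triangleℤ (a + b) - triangleℤ (+ 2 * a - b) - triangleℤ (+ 2 * b - a))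
      ≡⟨ twice-area c class 0<a+b 0≤2a-b 0≤2b-a ⟩
    twiceArea a b c ∎)
  where
  open ≡-Reasoning
  0≤2b-a : 0ℤ ≤ + 2 * b - a
  0≤2b-a = i≤j⇒0≤j-i a≤2b
  0≤2a-b : 0ℤ ≤ + 2 * a - b
  0≤2a-b = i≤j⇒0≤j-i b≤2a
  0<a+b : 0ℤ < a + b
  0<a+b = 0≤j-i-1⇒i<j
    (≡-nonNeg (e a b) (nonNeg-+ (nonNeg-+ (i≤j⇒0≤j-i 2≤a) (i≤j⇒0≤j-i 2≤b)) (+≤+ ℕ.z≤n)))
    where
    e : ∀ a b → a + b - 0ℤ - + 1 ≡ (a - + 2) + (b - + 2) + + 3
    e = solve-∀
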